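{- Let $S_1=\{\frac{1+y_k}{2} : k\in\mathbb{N}\}$ and $S_2=\{k^2:k\in\mathbb{N}\}$. For every integer $m\in\mathbb{N}\setminus(S_1\cap S_2)$, there are infinitely many positive integers $n$ for which there exists a weighting $f:E(K_n)\to\{ -1,1\}$ with $|f^{ -1}(-1)|=|f^{ -1}(1)|$ such that no copy $H$ of $K_m$ in $K_n$ satisfies $\sum_{e\in E(H)}f(e)=0$.
   Context: The sequence $(x_k,y_k)_{k\ge1}$ of solutions of the Pell equation $8x^2-8x+1=y^2$ is defined by $(x_1,y_1)=(1,1)$, $(x_2,y_2)=(3,7)$, and for $k\ge 3$: $y_k=6y_{k-1}-y_{k-2}$ and $x_k=\frac{y_k+x_{k-1}+1}{3}$. $K_n$ is the complete graph on $n$ vertices; a copy of $K_m$ is the complete subgraph on some $m$ of its vertices. -}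

module Defs where

open import Data.Nat using (ℕ; zero; suc; _+_; _*_; _∸_; _≤_)
open import Data.Integer as ℤ using (ℤ)
open import Data.Fin using (Fin; _<?_)
open import Data.Fin.Subset using (Subset; _∈_)
open import Data.Fin.Subset.Properties using (_∈?_)
open import Data.List using (List; filter; length; allFin; cartesianProduct; map; foldr)
open import Data.Product using (_×_; _,_; proj₁; proj₂; ∃)
open import Data.Sign as Sign using (Sign)
open import Relation.Binary.PropositionalEquality using (_≡_)
open import Relation.Nullary.Decidable using (_×-dec_)

-- Index 0 is a dummy value (0) and is never used (S1 quantifies over k ≥ 1).
-- The sequence is increasing, so truncated subtraction is exact for k ≥ 3.
pellY : ℕ → ℕ
pellY zero = 0
pellY (suc zero) = 1
pellY (suc (suc zero)) = 7
pellY (suc (suc (suc k))) = 6 * pellY (suc (suc k)) ∸ pellY (suc k)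

-- m ∈ S1 = { (1 + y_k)/2 : k ≥ 1 }   (written as 2m = 1 + y_k; all y_k are odd)
InS1 : ℕ → Set
InS1 m = ∃ λ k → 1 ≤ k × 2 * m ≡ 1 + pellY k

InS2 : ℕ → Set
InS2 m = ∃ λ k → m ≡ k * k

edges : (n : ℕ) → List (Fin n × Fin n)
edges n = filter (λ e → proj₁ e <? proj₂ e) (cartesianProduct (allFin n) (allFin n))

-- A weighting E(K_n) → {-1, 1}: the edge {i, j} with i < j gets weight  f i j.
-- (Values f i j with i ≥ j are irrelevant.)
Weighting : ℕ → Set
Weighting n = Fin n → Fin n → Sign

preimageSize : ∀ {n} → Weighting n → Sign → ℕ
preimageSize {n} f s = length (filter (λ e → f (proj₁ e) (proj₂ e) Sign.≟ s) (edges n))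

Balanced : ∀ {n} → Weighting n → Set
Balanced f = preimageSize f Sign.- ≡ preimageSize f Sign.+

signValue : Sign → ℤ
signValue Sign.+ = ℤ.1ℤ
signValue Sign.- = ℤ.-1ℤ

edgesOf : ∀ {n} → Subset n → List (Fin n × Fin n)
edgesOf {n} H = filter (λ e → (proj₁ e ∈? H) ×-dec (proj₂ e ∈? H)) (edges n)

weightSum : ∀ {n} → Weighting n → Subset n → ℤ
weightSum f H = foldr ℤ._+_ ℤ.0ℤ (map (λ e → signValue (f (proj₁ e) (proj₂ e))) (edgesOf H))

module Submission where

open import Defs
open import Data.Nat using (ℕ; _≤_)
open import Data.Integer using (0ℤ)
open import Data.Fin.Subset using (Subset; ∣_∣)
open import Data.Product using (_×_; _,_; ∃)
open import Relation.Binary.PropositionalEquality using (_≡_; _≢_)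
open import Relation.Nullary using (¬_; yes; no)

-- The vertices of K_n are coloured red and blue, and every edge gets the sign
-- prescribed for the colours of its ends (an EdgePattern).  The weight of a
-- clique then depends only on its numbers r and s of red and blue vertices
-- (twiceWeightSum), and a colouring of total weight zero is balanced.  So one
-- pattern plus an infinite family of zero-weight colourings settles m whenever
-- no r + s = m gives a zero-weight clique (patternGoodWeighting).
--   * m not a square: equal colours +1, mixed −1.  Twice the weight is
--     (r − s)² − (r + s), so a zero-weight K_m would make m a square; the
--     colourings with T N red and T (N + 1) blue vertices (triangular numbers)
--     have weight zero.
--   * m a square, hence m ∉ S₁: red–red −1, other edges +1.  A zero-weight
--     K_m gives the solution y = 2m − 1, v = 2r − 1 of y² + 1 = 2v²; by descent
--     every such solution lies in the Pell sequence, so m ∈ S₁.  Zero-weight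
--     colourings come from iterating the Pell automorphism on (r, s).

module EdgeSums where

  open import Data.Nat using (zero; suc)
  open import Data.Integer as ℤ using (ℤ; 0ℤ; +_; _+_)
  import Data.Integer.Properties as ℤP
  open import Data.Integer.Tactic.RingSolver using (solve-∀)
  open import Algebra.Properties.Monoid.Sum ℤP.+-0-monoid using (sum-syntax; sum-cong-≗)
  open import Data.Bool using (Bool; true; false; if_then_else_; _∧_)
  open import Data.Fin using (Fin; zero; suc; _<?_)
  open import Data.Fin.Subset using (Subset; ⊤)
  open import Data.Fin.Subset.Properties using (_∈?_; ∈⊤)
  open import Data.List using (List; []; _∷_; _++_; filter; allFin; tabulate; cartesianProduct; map; foldr; length)
  open import Data.List.Properties using (filter-all)
  open import Data.List.Relation.Unary.All using (universal)
  open import Data.Product using (_×_; _,_; proj₁; proj₂)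
  open import Data.Sign as Sign using (Sign)
  open import Function using (_∘_)
  open import Relation.Nullary using (does)
  open import Relation.Nullary.Decidable using (_×-dec_)
  open import Level using (Level)
  open import Relation.Unary using (Pred; Decidable)
  open import Relation.Binary.PropositionalEquality using (_≡_; refl; sym; trans; cong; cong₂; module ≡-Reasoning)

  iverson : Bool → ℤ → ℤ
  iverson b z = if b then z else 0ℤ

  listSum : {A : Set} → (A → ℤ) → List A → ℤ
  listSum h xs = foldr _+_ 0ℤ (map h xs)

  listSum-filter : {A : Set} {p : Level} {P : Pred A p} (P? : Decidable P) (h : A → ℤ) (xs : List A) →
    listSum h (filter P? xs) ≡ listSum (λ x → iverson (does (P? x)) (h x)) xs
  listSum-filter P? h [] = refl
  listSum-filter P? h (x ∷ xs) with does (P? x)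
  ... | true  = cong (λ s → h x + s) (listSum-filter P? h xs)
  ... | false = trans (listSum-filter P? h xs) (sym (ℤP.+-identityˡ _))

  listSum-++ : {A : Set} (h : A → ℤ) (xs ys : List A) → listSum h (xs ++ ys) ≡ listSum h xs + listSum h ys
  listSum-++ h []       ys = sym (ℤP.+-identityˡ _)
  listSum-++ h (x ∷ xs) ys = trans (cong (λ s → h x + s) (listSum-++ h xs ys)) (sym (ℤP.+-assoc (h x) _ _))

  listSum-map : {A B : Set} (h : B → ℤ) (g : A → B) (xs : List A) → listSum h (map g xs) ≡ listSum (h ∘ g) xs
  listSum-map h g []       = refl
  listSum-map h g (x ∷ xs) = cong (λ s → h (g x) + s) (listSum-map h g xs)

  listSum-cartesianProduct : {A B : Set} (h : A × B → ℤ) (xs : List A) (ys : List B) →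
    listSum h (cartesianProduct xs ys) ≡ listSum (λ x → listSum (λ y → h (x , y)) ys) xs
  listSum-cartesianProduct h []       ys = refl
  listSum-cartesianProduct h (x ∷ xs) ys = begin
    listSum h (map (x ,_) ys ++ cartesianProduct xs ys)
      ≡⟨ listSum-++ h (map (x ,_) ys) (cartesianProduct xs ys) ⟩
    listSum h (map (x ,_) ys) + listSum h (cartesianProduct xs ys)
      ≡⟨ cong₂ _+_ (listSum-map h (x ,_) ys) (listSum-cartesianProduct h xs ys) ⟩
    listSum (λ y → h (x , y)) ys + listSum (λ x → listSum (λ y → h (x , y)) ys) xs ∎
    where open ≡-Reasoning

  listSum-tabulate : {A : Set} (h : A → ℤ) → ∀ n (g : Fin n → A) → listSum h (tabulate g) ≡ ∑[ i < n ] h (g i)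
  listSum-tabulate h zero    g = refl
  listSum-tabulate h (suc n) g = cong (λ s → h (g zero) + s) (listSum-tabulate h n (g ∘ suc))

  edgeSum : ∀ n → (Fin n → Fin n → ℤ) → ℤ
  edgeSum n F = ∑[ i < n ] ∑[ j < n ] iverson (does (i <? j)) (F i j)

  -- The weight of the clique on H as an edge sum with the indicator of H: the two
  -- filters of edgesOf become indicators, and the product of the vertex lists a double sum.
  weightSum≡edgeSum : ∀ {n} (f : Weighting n) (H : Subset n) →
    weightSum f H ≡ edgeSum n (λ i j → iverson (does (i ∈? H) ∧ does (j ∈? H)) (signValue (f i j)))
  weightSum≡edgeSum {n} f H =
    trans (listSum-filter _ _ (edges n))
    (trans (listSum-filter _ _ (cartesianProduct (allFin n) (allFin n)))
    (trans (listSum-cartesianProduct _ (allFin n) (allFin n))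
    (trans (listSum-tabulate _ n (λ i → i))
           (sum-cong-≗ {n} (λ i → listSum-tabulate _ n (λ j → j))))))

  edgeSum-suc : ∀ n (F : Fin (suc n) → Fin (suc n) → ℤ) →
    edgeSum (suc n) F ≡ ∑[ j < n ] F zero (suc j) + edgeSum n (λ i j → F (suc i) (suc j))
  edgeSum-suc n F =
    cong₂ _+_ (ℤP.+-identityˡ (∑[ j < n ] F zero (suc j)))
              (sum-cong-≗ {n} (λ i → ℤP.+-identityˡ (∑[ j < n ] iverson (does (i <? j)) (F (suc i) (suc j)))))

  signSum-count : {A : Set} (s : A → Sign) (xs : List A) →
    listSum (signValue ∘ s) xs + + length (filter (λ x → s x Sign.≟ Sign.-) xs)
      ≡ + length (filter (λ x → s x Sign.≟ Sign.+) xs)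
  signSum-count s [] = refl
  signSum-count s (x ∷ xs) with s x
  ... | Sign.+ = trans (ℤP.+-assoc (+ 1) (listSum (signValue ∘ s) xs) _) (cong (λ z → + 1 + z) (signSum-count s xs))
  ... | Sign.- = trans (shift (listSum (signValue ∘ s) xs) _) (signSum-count s xs)
    where
    shift : ∀ a b → (ℤ.-1ℤ + a) + (+ 1 + b) ≡ a + b
    shift = solve-∀

  edgesOf⊤ : ∀ n → edgesOf (⊤ {n}) ≡ edges n
  edgesOf⊤ n = filter-all (λ e → (proj₁ e ∈? ⊤) ×-dec (proj₂ e ∈? ⊤)) (universal (λ e → ∈⊤ , ∈⊤) (edges n))

  balanced-if-total-zero : ∀ {n} (f : Weighting n) → weightSum f ⊤ ≡ 0ℤ → Balanced f
  balanced-if-total-zero {n} f total = ℤP.+-injective (begin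
    + preimageSize f Sign.-                        ≡⟨ sym (ℤP.+-identityˡ _) ⟩
    0ℤ + + preimageSize f Sign.-                   ≡⟨ cong (_+ + preimageSize f Sign.-) (sym total') ⟩
    listSum sign (edges n) + + preimageSize f Sign.- ≡⟨ signSum-count (λ e → f (proj₁ e) (proj₂ e)) (edges n) ⟩
    + preimageSize f Sign.+                        ∎)
    where
    open ≡-Reasoning
    sign : Fin n × Fin n → ℤ
    sign e = signValue (f (proj₁ e) (proj₂ e))
    total' : listSum sign (edges n) ≡ 0ℤ
    total' = trans (cong (listSum sign) (sym (edgesOf⊤ n))) total

module ColourPatterns where

  open EdgeSums
  open import Data.Nat as ℕ using (ℕ; zero; suc; _≤_)
  import Data.Nat.Properties as ℕP
  open import Data.Integer as ℤ using (ℤ; 0ℤ; 1ℤ; +_; _+_; _*_; _-_)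
  import Data.Integer.Properties as ℤP
  open import Data.Integer.Tactic.RingSolver using (solve-∀)
  open import Algebra.Properties.Monoid.Sum ℤP.+-0-monoid using (sum-syntax; sum-replicate-zero)
  open import Data.Bool using (Bool; _∧_)
  open import Data.Fin using (Fin; zero; suc)
  open import Data.Fin.Subset using (Subset; ⊤; inside; outside; _∩_; ∁; ∣_∣)
  open import Data.Fin.Subset.Properties using (_∈?_; ∩-identityˡ)
  open import Data.Vec using ([]; _∷_; lookup; replicate; _++_)
  open import Data.Product using (_×_; _,_; ∃)
  open import Data.Sign as Sign using (Sign)
  open import Relation.Nullary using (does)
  open import Relation.Binary.PropositionalEquality using (_≡_; _≢_; refl; sym; trans; cong; cong₂; module ≡-Reasoning)

  record EdgePattern : Set where
    constructor colourRule
    field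
      redRed blueBlue mixed : Sign
  open EdgePattern

  -- A colouring is the subset R of red vertices; a vertex's colour is its entry
  -- in R: inside = red, outside = blue.
  edgeSign : EdgePattern → Bool → Bool → Sign
  edgeSign p inside  inside  = redRed p
  edgeSign p outside outside = blueBlue p
  edgeSign p _       _       = mixed p

  patternWeighting : ∀ {n} → EdgePattern → Subset n → Weighting n
  patternWeighting p R i j = edgeSign p (lookup R i) (lookup R j)

  -- Twice the weight of a clique with a red and b blue vertices:
  -- a(a-1)/2 red–red, b(b-1)/2 blue–blue and ab mixed edges.
  twiceCliqueWeight : EdgePattern → ℤ → ℤ → ℤ
  twiceCliqueWeight p a b =
    a * (a - 1ℤ) * signValue (redRed p) + b * (b - 1ℤ) * signValue (blueBlue p)
      + + 2 * a * b * signValue (mixed p)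

  rowSum : ∀ p e {n} (R H : Subset n) →
    ∑[ j < n ] iverson (does (j ∈? H)) (signValue (edgeSign p e (lookup R j)))
      ≡ + ∣ H ∩ R ∣ * signValue (edgeSign p e inside) + + ∣ H ∩ ∁ R ∣ * signValue (edgeSign p e outside)
  rowSum p e []            []            = refl
  rowSum p e (inside  ∷ R) (inside  ∷ H) =
    trans (cong (λ s → signValue (edgeSign p e inside) + s) (rowSum p e R H))
          (addRed (+ ∣ H ∩ R ∣) (+ ∣ H ∩ ∁ R ∣) (signValue (edgeSign p e inside)) (signValue (edgeSign p e outside)))
    where
    addRed : ∀ a b x y → x + (a * x + b * y) ≡ (1ℤ + a) * x + b * y
    addRed = solve-∀
  rowSum p e (outside ∷ R) (inside  ∷ H) =
    trans (cong (λ s → signValue (edgeSign p e outside) + s) (rowSum p e R H))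
          (addBlue (+ ∣ H ∩ R ∣) (+ ∣ H ∩ ∁ R ∣) (signValue (edgeSign p e inside)) (signValue (edgeSign p e outside)))
    where
    addBlue : ∀ a b x y → y + (a * x + b * y) ≡ a * x + (1ℤ + b) * y
    addBlue = solve-∀
  rowSum p e (_       ∷ R) (outside ∷ H) = trans (ℤP.+-identityˡ _) (rowSum p e R H)

  cliqueTerm : ∀ {n} → EdgePattern → Subset n → Subset n → Fin n → Fin n → ℤ
  cliqueTerm p R H i j = iverson (does (i ∈? H) ∧ does (j ∈? H)) (signValue (patternWeighting p R i j))

  addVertex : ∀ p c v {n} (R H : Subset n) →
    + 2 * (∑[ j < n ] cliqueTerm p (c ∷ R) (v ∷ H) zero (suc j))
        + twiceCliqueWeight p (+ ∣ H ∩ R ∣) (+ ∣ H ∩ ∁ R ∣)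
      ≡ twiceCliqueWeight p (+ ∣ (v ∷ H) ∩ (c ∷ R) ∣) (+ ∣ (v ∷ H) ∩ ∁ (c ∷ R) ∣)
  addVertex p inside  inside R H =
    trans (cong (λ s → + 2 * s + twiceCliqueWeight p a b) (rowSum p inside R H))
          (newRed a b (signValue (redRed p)) (signValue (blueBlue p)) (signValue (mixed p)))
    where
    a b : ℤ
    a = + ∣ H ∩ R ∣
    b = + ∣ H ∩ ∁ R ∣
    newRed : ∀ a b x y z → + 2 * (a * x + b * z) + (a * (a - 1ℤ) * x + b * (b - 1ℤ) * y + + 2 * a * b * z)
                           ≡ (1ℤ + a) * ((1ℤ + a) - 1ℤ) * x + b * (b - 1ℤ) * y + + 2 * (1ℤ + a) * b * z
    newRed = solve-∀
  addVertex p outside inside R H =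
    trans (cong (λ s → + 2 * s + twiceCliqueWeight p a b) (rowSum p outside R H))
          (newBlue a b (signValue (redRed p)) (signValue (blueBlue p)) (signValue (mixed p)))
    where
    a b : ℤ
    a = + ∣ H ∩ R ∣
    b = + ∣ H ∩ ∁ R ∣
    newBlue : ∀ a b x y z → + 2 * (a * z + b * y) + (a * (a - 1ℤ) * x + b * (b - 1ℤ) * y + + 2 * a * b * z)
                            ≡ a * (a - 1ℤ) * x + (1ℤ + b) * ((1ℤ + b) - 1ℤ) * y + + 2 * a * (1ℤ + b) * z
    newBlue = solve-∀
  addVertex p c outside {n} R H =
    trans (cong (λ s → + 2 * s + twiceCliqueWeight p (+ ∣ H ∩ R ∣) (+ ∣ H ∩ ∁ R ∣)) (sum-replicate-zero n))
          (ℤP.+-identityˡ _)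

  twiceEdgeSum : ∀ p {n} (R H : Subset n) →
    + 2 * edgeSum n (cliqueTerm p R H) ≡ twiceCliqueWeight p (+ ∣ H ∩ R ∣) (+ ∣ H ∩ ∁ R ∣)
  twiceEdgeSum p []      []      = emptyClique (signValue (redRed p)) (signValue (blueBlue p)) (signValue (mixed p))
    where
    emptyClique : ∀ x y z → 0ℤ ≡ 0ℤ * (0ℤ - 1ℤ) * x + 0ℤ * (0ℤ - 1ℤ) * y + + 2 * 0ℤ * 0ℤ * z
    emptyClique = solve-∀
  twiceEdgeSum p {suc n} (c ∷ R) (v ∷ H) = begin
    + 2 * edgeSum (suc n) (cliqueTerm p (c ∷ R) (v ∷ H))
      ≡⟨ cong (+ 2 *_) (edgeSum-suc n (cliqueTerm p (c ∷ R) (v ∷ H))) ⟩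
    + 2 * (row + edgeSum n (cliqueTerm p R H))
      ≡⟨ ℤP.*-distribˡ-+ (+ 2) row (edgeSum n (cliqueTerm p R H)) ⟩
    + 2 * row + + 2 * edgeSum n (cliqueTerm p R H)
      ≡⟨ cong (λ s → + 2 * row + s) (twiceEdgeSum p R H) ⟩
    + 2 * row + twiceCliqueWeight p (+ ∣ H ∩ R ∣) (+ ∣ H ∩ ∁ R ∣)
      ≡⟨ addVertex p c v R H ⟩
    twiceCliqueWeight p (+ ∣ (v ∷ H) ∩ (c ∷ R) ∣) (+ ∣ (v ∷ H) ∩ ∁ (c ∷ R) ∣) ∎
    where
    open ≡-Reasoning
    row : ℤ
    row = ∑[ j < n ] cliqueTerm p (c ∷ R) (v ∷ H) zero (suc j)

  twiceWeightSum : ∀ p {n} (R H : Subset n) →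
    + 2 * weightSum (patternWeighting p R) H ≡ twiceCliqueWeight p (+ ∣ H ∩ R ∣) (+ ∣ H ∩ ∁ R ∣)
  twiceWeightSum p R H = trans (cong (+ 2 *_) (weightSum≡edgeSum (patternWeighting p R) H)) (twiceEdgeSum p R H)

  colouring : ∀ t b → Subset (t ℕ.+ b)
  colouring t b = replicate t inside ++ replicate b outside

  ∣colouring∣ : ∀ t b → ∣ colouring t b ∣ ≡ t
  ∣colouring∣ zero    zero    = refl
  ∣colouring∣ zero    (suc b) = ∣colouring∣ zero b
  ∣colouring∣ (suc t) b       = cong suc (∣colouring∣ t b)

  ∣∁colouring∣ : ∀ t b → ∣ ∁ (colouring t b) ∣ ≡ b
  ∣∁colouring∣ zero    zero    = refl
  ∣∁colouring∣ zero    (suc b) = cong suc (∣∁colouring∣ zero b)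
  ∣∁colouring∣ (suc t) b       = ∣∁colouring∣ t b

  ∣H∣≡red+blue : ∀ {n} (R H : Subset n) → ∣ H ∣ ≡ ∣ H ∩ R ∣ ℕ.+ ∣ H ∩ ∁ R ∣
  ∣H∣≡red+blue []            []            = refl
  ∣H∣≡red+blue (inside  ∷ R) (inside  ∷ H) = cong suc (∣H∣≡red+blue R H)
  ∣H∣≡red+blue (outside ∷ R) (inside  ∷ H) =
    trans (cong suc (∣H∣≡red+blue R H)) (sym (ℕP.+-suc ∣ H ∩ R ∣ ∣ H ∩ ∁ R ∣))
  ∣H∣≡red+blue (_       ∷ R) (outside ∷ H) = ∣H∣≡red+blue R H

  half-zero : ∀ x → + 2 * x ≡ 0ℤ → x ≡ 0ℤ
  half-zero x 2x≡0 = ℤP.*-cancelˡ-≡ (+ 2) x 0ℤ (trans 2x≡0 (sym (ℤP.*-zeroʳ (+ 2))))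

  GoodWeighting : ℕ → ℕ → Set
  GoodWeighting m N = ∃ λ n → N ≤ n × ∃ λ (f : Weighting n) → Balanced f ×
    ((H : Subset n) → ∣ H ∣ ≡ m → weightSum f H ≢ 0ℤ)

  patternGoodWeighting : ∀ p m N t b → N ≤ t ℕ.+ b →
    twiceCliqueWeight p (+ t) (+ b) ≡ 0ℤ →
    (∀ r s → r ℕ.+ s ≡ m → twiceCliqueWeight p (+ r) (+ s) ≢ 0ℤ) →
    GoodWeighting m N
  patternGoodWeighting p m N t b N≤n total≡0 cliques≢0 =
    t ℕ.+ b , N≤n , patternWeighting p R , balanced , noZeroClique
    where
    R : Subset (t ℕ.+ b)
    R = colouring t b
    balanced : Balanced (patternWeighting p R)
    balanced = balanced-if-total-zero (patternWeighting p R)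
      (half-zero _ (trans (twiceWeightSum p R ⊤)
        (trans (cong₂ (λ r s → twiceCliqueWeight p (+ r) (+ s))
                      (trans (cong ∣_∣ (∩-identityˡ R)) (∣colouring∣ t b))
                      (trans (cong ∣_∣ (∩-identityˡ (∁ R))) (∣∁colouring∣ t b)))
               total≡0)))
    noZeroClique : (H : Subset (t ℕ.+ b)) → ∣ H ∣ ≡ m → weightSum (patternWeighting p R) H ≢ 0ℤ
    noZeroClique H ∣H∣≡m weight≡0 =
      cliques≢0 ∣ H ∩ R ∣ ∣ H ∩ ∁ R ∣ (trans (sym (∣H∣≡red+blue R H)) ∣H∣≡m)
        (trans (sym (twiceWeightSum p R H)) (cong (+ 2 *_) weight≡0))

module PellEquation where

  open import Data.Nat
  open import Data.Nat.Properties
  open import Data.Nat.Induction using (<-rec)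
  open import Data.Nat.Tactic.RingSolver using (solve-∀)
  open import Data.Product using (_×_; _,_; proj₁; ∃; ∃₂)
  open import Data.Empty using (⊥-elim)
  open import Relation.Binary.PropositionalEquality

  IsPell : ℕ → ℕ → Set
  IsPell y u = y * y + 1 ≡ 2 * (u * u)

  Y U : ℕ → ℕ
  Y zero    = 1
  Y (suc i) = 3 * Y i + 4 * U i
  U zero    = 1
  U (suc i) = 2 * Y i + 3 * U i

  InPellSequence : ℕ → ℕ → Set
  InPellSequence y u = ∃ λ i → Y i ≡ y × U i ≡ u

  pellY≡Y : ∀ i → pellY (suc i) ≡ Y i
  pellY≡Y i = proj₁ (consecutive i)
    where
    -- Y satisfies y_{i+2} = 6 y_{i+1} - y_i, as 6 Y (i+1) = Y (i+2) + Y i.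
    consecutive : ∀ i → pellY (suc i) ≡ Y i × pellY (suc (suc i)) ≡ Y (suc i)
    consecutive zero    = refl , refl
    consecutive (suc i) with consecutive i
    ... | yᵢ , yᵢ₊₁ = yᵢ₊₁ , (begin
      6 * pellY (suc (suc i)) ∸ pellY (suc i) ≡⟨ cong₂ (λ a b → 6 * a ∸ b) yᵢ₊₁ yᵢ ⟩
      6 * Y (suc i) ∸ Y i                     ≡⟨ cong (_∸ Y i) (recurrence (Y i) (U i)) ⟩
      Y (suc (suc i)) + Y i ∸ Y i             ≡⟨ m+n∸n≡m (Y (suc (suc i))) (Y i) ⟩
      Y (suc (suc i))                         ∎)
      where
      open ≡-Reasoning
      recurrence : ∀ y u → 6 * (3 * y + 4 * u) ≡ (3 * (3 * y + 4 * u) + 4 * (2 * y + 3 * u)) + y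
      recurrence = solve-∀

  square-reflect-≤ : ∀ {m n} → m * m ≤ n * n → m ≤ n
  square-reflect-≤ m²≤n² = ≮⇒≥ (λ n<m → <⇒≱ (*-mono-< n<m n<m) m²≤n²)

  square-reflect-< : ∀ {m n} → m * m < n * n → m < n
  square-reflect-< m²<n² = ≰⇒> (λ n≤m → <⇒≱ m²<n² (*-mono-≤ n≤m n≤m))

  module Estimates {y u : ℕ} (sol : IsPell y u) (u≥2 : 2 ≤ u) where
    open ≤-Reasoning

    y<2u : y < 2 * u
    y<2u = square-reflect-< (begin-strict
      y * y                 <⟨ m<m+n (y * y) z<s ⟩
      y * y + 1             ≡⟨ sol ⟩
      2 * (u * u)           ≤⟨ m≤m+n (2 * (u * u)) (2 * (u * u)) ⟩
      2 * (u * u) + 2 * (u * u) ≡⟨ square2 u ⟩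
      (2 * u) * (2 * u)     ∎)
      where
      square2 : ∀ u → 2 * (u * u) + 2 * (u * u) ≡ (2 * u) * (2 * u)
      square2 = solve-∀

    2y≤3u : 2 * y ≤ 3 * u
    2y≤3u = square-reflect-≤ (begin
      (2 * y) * (2 * y)     ≤⟨ m≤m+n ((2 * y) * (2 * y)) 4 ⟩
      (2 * y) * (2 * y) + 4 ≡⟨ square2 y ⟩
      4 * (y * y + 1)       ≡⟨ cong (4 *_) sol ⟩
      4 * (2 * (u * u))     ≤⟨ m≤m+n (4 * (2 * (u * u))) (u * u) ⟩
      4 * (2 * (u * u)) + u * u ≡⟨ square3 u ⟩
      (3 * u) * (3 * u)     ∎)
      where
      square2 : ∀ y → (2 * y) * (2 * y) + 4 ≡ 4 * (y * y + 1)
      square2 = solve-∀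
      square3 : ∀ u → 4 * (2 * (u * u)) + u * u ≡ (3 * u) * (3 * u)
      square3 = solve-∀

    -- y ≥ 3, since y ≤ 2 would give y² + 1 ≤ 5 < 8 ≤ 2u².
    3≤y : 3 ≤ y
    3≤y = ≰⇒> λ y≤2 → <⇒≱ (begin-strict
      y * y + 1   ≤⟨ +-monoˡ-≤ 1 (*-mono-≤ y≤2 y≤2) ⟩
      5           <⟨ m<m+n 5 {3} z<s ⟩
      2 * (2 * 2) ≤⟨ *-monoʳ-≤ 2 (*-mono-≤ u≥2 u≥2) ⟩
      2 * (u * u) ∎) (≤-reflexive (sym sol))

    4u≤3y : 4 * u ≤ 3 * y
    4u≤3y = square-reflect-≤ (begin
      (4 * u) * (4 * u)     ≡⟨ square4 u ⟩
      8 * (2 * (u * u))     ≡⟨ cong (8 *_) (sym sol) ⟩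
      8 * (y * y + 1)       ≡⟨ *-distribˡ-+ 8 (y * y) 1 ⟩
      8 * (y * y) + 8       ≤⟨ +-monoʳ-≤ (8 * (y * y)) (≤-trans (n≤1+n 8) (*-mono-≤ 3≤y 3≤y)) ⟩
      8 * (y * y) + y * y   ≡⟨ square3 y ⟩
      (3 * y) * (3 * y)     ∎)
      where
      square4 : ∀ u → (4 * u) * (4 * u) ≡ 8 * (2 * (u * u))
      square4 = solve-∀
      square3 : ∀ y → 8 * (y * y) + y * y ≡ (3 * y) * (3 * y)
      square3 = solve-∀

  -- Descent: a solution with u ≥ 2 is the successor of a solution with smaller y,
  -- namely (3y - 4u, 3u - 2y).
  descent : ∀ {y u} → IsPell y u → 2 ≤ u →
    ∃₂ λ y′ u′ → y′ < y × IsPell y′ u′ × y ≡ 3 * y′ + 4 * u′ × u ≡ 2 * y′ + 3 * u′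
  descent {y} {u} sol u≥2 = y′ , u′ , y′<y , sol′ , y≡ , u≡
    where
    open Estimates {y} {u} sol u≥2
    y′ u′ : ℕ
    y′ = 3 * y ∸ 4 * u
    u′ = 3 * u ∸ 2 * y
    3y≡ : 3 * y ≡ y′ + 4 * u
    3y≡ = sym (m∸n+n≡m 4u≤3y)
    3u≡ : 3 * u ≡ u′ + 2 * y
    3u≡ = sym (m∸n+n≡m 2y≤3u)

    y≡ : y ≡ 3 * y′ + 4 * u′
    y≡ = +-cancelˡ-≡ (8 * y) y (3 * y′ + 4 * u′) (begin
      8 * y + y                 ≡⟨ ring₁ y ⟩
      3 * (3 * y)               ≡⟨ cong (3 *_) 3y≡ ⟩
      3 * (y′ + 4 * u)          ≡⟨ ring₂ y′ u ⟩
      3 * y′ + 4 * (3 * u)      ≡⟨ cong (λ z → 3 * y′ + 4 * z) 3u≡ ⟩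
      3 * y′ + 4 * (u′ + 2 * y) ≡⟨ ring₃ y y′ u′ ⟩
      8 * y + (3 * y′ + 4 * u′) ∎)
      where
      open ≡-Reasoning
      ring₁ : ∀ y → 8 * y + y ≡ 3 * (3 * y)
      ring₁ = solve-∀
      ring₂ : ∀ y′ u → 3 * (y′ + 4 * u) ≡ 3 * y′ + 4 * (3 * u)
      ring₂ = solve-∀
      ring₃ : ∀ y y′ u′ → 3 * y′ + 4 * (u′ + 2 * y) ≡ 8 * y + (3 * y′ + 4 * u′)
      ring₃ = solve-∀

    u≡ : u ≡ 2 * y′ + 3 * u′
    u≡ = +-cancelˡ-≡ (8 * u) u (2 * y′ + 3 * u′) (begin
      8 * u + u                 ≡⟨ ring₁ u ⟩
      3 * (3 * u)               ≡⟨ cong (3 *_) 3u≡ ⟩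
      3 * (u′ + 2 * y)          ≡⟨ ring₂ u′ y ⟩
      3 * u′ + 2 * (3 * y)      ≡⟨ cong (λ z → 3 * u′ + 2 * z) 3y≡ ⟩
      3 * u′ + 2 * (y′ + 4 * u) ≡⟨ ring₃ u u′ y′ ⟩
      8 * u + (2 * y′ + 3 * u′) ∎)
      where
      open ≡-Reasoning
      ring₁ : ∀ u → 8 * u + u ≡ 3 * (3 * u)
      ring₁ = solve-∀
      ring₂ : ∀ u′ y → 3 * (u′ + 2 * y) ≡ 3 * u′ + 2 * (3 * y)
      ring₂ = solve-∀
      ring₃ : ∀ u u′ y′ → 3 * u′ + 2 * (y′ + 4 * u) ≡ 8 * u + (2 * y′ + 3 * u′)
      ring₃ = solve-∀

    -- y′ + 2y < y′ + 4u = 3y = y + 2y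
    y′<y : y′ < y
    y′<y = +-cancelʳ-< (2 * y) y′ y (begin-strict
      y′ + 2 * y          <⟨ +-monoʳ-< y′ (*-monoʳ-< 2 y<2u) ⟩
      y′ + 2 * (2 * u)    ≡⟨ cong (y′ +_) (double2 u) ⟩
      y′ + 4 * u          ≡⟨ sym 3y≡ ⟩
      3 * y               ≡⟨ triple y ⟩
      y + 2 * y           ∎)
      where
      open ≤-Reasoning
      double2 : ∀ u → 2 * (2 * u) ≡ 4 * u
      double2 = solve-∀
      triple : ∀ y → 3 * y ≡ y + 2 * y
      triple = solve-∀

    sol′ : IsPell y′ u′
    sol′ = +-cancelˡ-≡ common (y′ * y′ + 1) (2 * (u′ * u′)) (begin
      common + (y′ * y′ + 1)                          ≡⟨ expandY y′ u′ ⟩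
      (3 * y′ + 4 * u′) * (3 * y′ + 4 * u′) + 1       ≡⟨ cong (λ z → z * z + 1) (sym y≡) ⟩
      y * y + 1                                       ≡⟨ sol ⟩
      2 * (u * u)                                     ≡⟨ cong (λ z → 2 * (z * z)) u≡ ⟩
      2 * ((2 * y′ + 3 * u′) * (2 * y′ + 3 * u′))     ≡⟨ expandU y′ u′ ⟩
      common + 2 * (u′ * u′)                          ∎)
      where
      open ≡-Reasoning
      common : ℕ
      common = 8 * (y′ * y′) + 24 * (y′ * u′) + 16 * (u′ * u′)
      expandY : ∀ a b → (8 * (a * a) + 24 * (a * b) + 16 * (b * b)) + (a * a + 1) ≡ (3 * a + 4 * b) * (3 * a + 4 * b) + 1
      expandY = solve-∀
      expandU : ∀ a b → 2 * ((2 * a + 3 * b) * (2 * a + 3 * b)) ≡ (8 * (a * a) + 24 * (a * b) + 16 * (b * b)) + 2 * (b * b)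
      expandU = solve-∀

  -- Every solution of y² + 1 = 2u² in ℕ is some (Y i, U i).
  -- By well-founded induction on y: (1, 1) is the only solution with u ≤ 1,
  -- and descent reduces every other solution to a smaller one.
  pellSolutions : ∀ y u → IsPell y u → InPellSequence y u
  pellSolutions = <-rec (λ y → ∀ u → IsPell y u → InPellSequence y u) classify
    where
    classify : ∀ y → (∀ {y′} → y′ < y → ∀ u → IsPell y′ u → InPellSequence y′ u) →
               ∀ u → IsPell y u → InPellSequence y u
    classify y rec zero          sol = ⊥-elim (1+n≢0 (trans (+-comm 1 (y * y)) sol))
    classify y rec (suc zero)    sol = 0 , sym (m*n≡1⇒m≡1 y y (+-cancelʳ-≡ 1 (y * y) 1 sol)) , refl
    classify y rec u@(suc (suc _)) sol = successor (descent sol (s≤s (s≤s z≤n)))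
      where
      successor : (∃₂ λ y′ u′ → y′ < y × IsPell y′ u′ × y ≡ 3 * y′ + 4 * u′ × u ≡ 2 * y′ + 3 * u′) →
                  InPellSequence y u
      successor (y′ , u′ , y′<y , sol′ , y≡ , u≡) with rec y′<y u′ sol′
      ... | i , Yi≡y′ , Ui≡u′ =
        suc i , trans (cong₂ (λ a b → 3 * a + 4 * b) Yi≡y′ Ui≡u′) (sym y≡)
              , trans (cong₂ (λ a b → 2 * a + 3 * b) Yi≡y′ Ui≡u′) (sym u≡)

  pell⇒S1 : ∀ m u → IsPell (2 * m + 1) u → InS1 (suc m)
  pell⇒S1 m u sol = inS1 (pellSolutions (2 * m + 1) u sol)
    where
    double : ∀ m → 2 * suc m ≡ 1 + (2 * m + 1)
    double = solve-∀
    inS1 : InPellSequence (2 * m + 1) u → InS1 (suc m)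
    inS1 (i , Yi≡y , _) = suc i , s≤s z≤n , trans (double m) (cong suc (sym (trans (pellY≡Y i) Yi≡y)))

module Constructions where

  open ColourPatterns
  open PellEquation using (IsPell; pell⇒S1)
  open import Data.Nat as ℕ using (ℕ; zero; suc; _≤_; _<_; z≤n; s≤s)
  import Data.Nat.Properties as ℕP
  import Data.Nat.Tactic.RingSolver as ℕ-Solver
  open import Data.Integer as ℤ using (ℤ; 0ℤ; 1ℤ; +_; _+_; _*_; _-_)
  import Data.Integer.Properties as ℤP
  open import Data.Integer.Tactic.RingSolver using (solve-∀)
  open import Data.Fin using (toℕ; fromℕ<)
  open import Data.Fin.Properties using (any?; toℕ-fromℕ<)
  open import Data.Product using (_,_; ∃)
  open import Data.Sign as Sign using (Sign)
  open import Relation.Nullary using (¬_; Dec)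
  open import Relation.Nullary.Decidable using (map′)
  open import Relation.Binary.PropositionalEquality

  square-abs : ∀ v → + (ℤ.∣ v ∣ ℕ.* ℤ.∣ v ∣) ≡ v * v
  square-abs (+ n)      = ℤP.pos-* n n
  square-abs ℤ.-[1+ n ] = refl

  -- Being a square is decidable: a root of m is at most m.
  InS2? : ∀ m → Dec (InS2 m)
  InS2? m = map′ (λ (k , m≡k²) → toℕ k , m≡k²) bounded (any? (λ k → m ℕP.≟ toℕ k ℕ.* toℕ k))
    where
    k≤k² : ∀ k → k ≤ k ℕ.* k
    k≤k² zero    = z≤n
    k≤k² (suc k) = ℕP.m≤m*n (suc k) (suc k)
    bounded : InS2 m → ∃ λ k → m ≡ toℕ k ℕ.* toℕ k
    bounded (k , m≡k²) = fromℕ< k<1+m , subst (λ j → m ≡ j ℕ.* j) (sym (toℕ-fromℕ< k<1+m)) m≡k²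
      where
      k<1+m : k < suc m
      k<1+m = s≤s (subst (k ≤_) (sym m≡k²) (k≤k² k))

  bipartite : EdgePattern
  bipartite = colourRule Sign.+ Sign.+ Sign.-

  -- With r red and s blue vertices, twice the weight is (r - s)² - (r + s);
  -- so a zero-weight clique has a square number of vertices.
  bipartite-zero⇒square : ∀ r s → twiceCliqueWeight bipartite (+ r) (+ s) ≡ 0ℤ → InS2 (r ℕ.+ s)
  bipartite-zero⇒square r s weight≡0 = ℤ.∣ + r - + s ∣ , ℤP.+-injective (begin
    + r + + s                          ≡⟨ sym (ℤP.+-identityʳ (+ r + + s)) ⟩
    + r + + s + 0ℤ                     ≡⟨ cong (λ w → + r + + s + w) (sym weight≡0) ⟩
    + r + + s + twiceCliqueWeight bipartite (+ r) (+ s) ≡⟨ difference² (+ r) (+ s) ⟩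
    (+ r - + s) * (+ r - + s)          ≡⟨ sym (square-abs (+ r - + s)) ⟩
    + (ℤ.∣ + r - + s ∣ ℕ.* ℤ.∣ + r - + s ∣) ∎)
    where
    open ≡-Reasoning
    difference² : ∀ a b → a + b + (a * (a - 1ℤ) * 1ℤ + b * (b - 1ℤ) * 1ℤ + + 2 * a * b * ℤ.-1ℤ) ≡ (a - b) * (a - b)
    difference² = solve-∀

  triangular : ℕ → ℕ
  triangular zero    = 0
  triangular (suc k) = k ℕ.+ triangular k

  twice-triangular : ∀ k → + 2 * + triangular k + + k ≡ + k * + k
  twice-triangular zero    = refl
  twice-triangular (suc k) = begin
    + 2 * (+ k + t) + (1ℤ + + k) ≡⟨ regroup (+ k) t ⟩
    (+ 2 * t + + k) + (+ 2 * + k + 1ℤ) ≡⟨ cong (_+ (+ 2 * + k + 1ℤ)) (twice-triangular k) ⟩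
    + k * + k + (+ 2 * + k + 1ℤ) ≡⟨ square (+ k) ⟩
    (1ℤ + + k) * (1ℤ + + k) ∎
    where
    open ≡-Reasoning
    t : ℤ
    t = + triangular k
    regroup : ∀ k t → + 2 * (k + t) + (1ℤ + k) ≡ (+ 2 * t + k) + (+ 2 * k + 1ℤ)
    regroup = solve-∀
    square : ∀ k → k * k + (+ 2 * k + 1ℤ) ≡ (1ℤ + k) * (1ℤ + k)
    square = solve-∀

  -- T k red and T (k + 1) blue vertices: (r - s)² = k² = r + s, so the total weight is zero.
  bipartite-balanced : ∀ k → twiceCliqueWeight bipartite (+ triangular k) (+ triangular (suc k)) ≡ 0ℤ
  bipartite-balanced k = begin
    twiceCliqueWeight bipartite t (+ k + t) ≡⟨ expand t (+ k) ⟩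
    + k * + k - (+ 2 * t + + k)             ≡⟨ cong (λ w → + k * + k - w) (twice-triangular k) ⟩
    + k * + k - + k * + k                   ≡⟨ ℤP.+-inverseʳ (+ k * + k) ⟩
    0ℤ                                      ∎
    where
    open ≡-Reasoning
    t : ℤ
    t = + triangular k
    expand : ∀ t k → t * (t - 1ℤ) * 1ℤ + (k + t) * ((k + t) - 1ℤ) * 1ℤ + + 2 * t * (k + t) * ℤ.-1ℤ ≡ k * k - (+ 2 * t + k)
    expand = solve-∀

  nonSquareCase : ∀ m → ¬ InS2 m → ∀ N → GoodWeighting m N
  nonSquareCase m notSquare N =
    patternGoodWeighting bipartite m N (triangular N) (triangular (suc N)) N≤n (bipartite-balanced N)
      (λ r s r+s≡m weight≡0 → notSquare (subst InS2 r+s≡m (bipartite-zero⇒square r s weight≡0)))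
    where
    N≤n : N ≤ triangular N ℕ.+ triangular (suc N)
    N≤n = ℕP.≤-trans (ℕP.m≤m+n N (triangular N)) (ℕP.m≤n+m (N ℕ.+ triangular N) (triangular N))

  cliqueRule : EdgePattern
  cliqueRule = colourRule Sign.- Sign.+ Sign.+

  pell-from-ℤ : ∀ y v → + y * + y + 1ℤ ≡ + 2 * (v * v) → IsPell y ℤ.∣ v ∣
  pell-from-ℤ y v eq = ℤP.+-injective (begin
    + (y ℕ.* y) + 1ℤ           ≡⟨ cong (_+ 1ℤ) (ℤP.pos-* y y) ⟩
    + y * + y + 1ℤ             ≡⟨ eq ⟩
    + 2 * (v * v)              ≡⟨ cong (+ 2 *_) (sym (square-abs v)) ⟩
    + 2 * + (ℤ.∣ v ∣ ℕ.* ℤ.∣ v ∣) ≡⟨ sym (ℤP.pos-* 2 (ℤ.∣ v ∣ ℕ.* ℤ.∣ v ∣)) ⟩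
    + (2 ℕ.* (ℤ.∣ v ∣ ℕ.* ℤ.∣ v ∣)) ∎)
    where open ≡-Reasoning

  -- A zero-weight clique with r red and s blue vertices, r + s = m + 1, gives the
  -- Pell solution y = 2(r + s) - 1, v = 2r - 1; hence m + 1 ∈ S₁.
  cliqueRule-zero⇒S1 : ∀ r s m → r ℕ.+ s ≡ suc m → twiceCliqueWeight cliqueRule (+ r) (+ s) ≡ 0ℤ → InS1 (suc m)
  cliqueRule-zero⇒S1 r s m r+s≡1+m weight≡0 = pell⇒S1 m ℤ.∣ v ∣ (pell-from-ℤ (2 ℕ.* m ℕ.+ 1) v (begin
    y * y + 1ℤ                                  ≡⟨ cong (λ z → z * z + 1ℤ) y≡ ⟩
    (+ 2 * (a + b) - 1ℤ) * (+ 2 * (a + b) - 1ℤ) + 1ℤ ≡⟨ pellForm a b ⟩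
    + 2 * (v * v) + + 4 * twiceCliqueWeight cliqueRule a b ≡⟨ cong (λ w → + 2 * (v * v) + + 4 * w) weight≡0 ⟩
    + 2 * (v * v) + 0ℤ                          ≡⟨ ℤP.+-identityʳ (+ 2 * (v * v)) ⟩
    + 2 * (v * v)                               ∎))
    where
    open ≡-Reasoning
    a b y v : ℤ
    a = + r
    b = + s
    y = + (2 ℕ.* m ℕ.+ 1)
    v = + 2 * a - 1ℤ
    y≡ : y ≡ + 2 * (a + b) - 1ℤ
    y≡ = begin
      + (2 ℕ.* m) + 1ℤ           ≡⟨ cong (_+ 1ℤ) (ℤP.pos-* 2 m) ⟩
      + 2 * + m + 1ℤ             ≡⟨ odd (+ m) ⟩
      + 2 * (1ℤ + + m) - 1ℤ      ≡⟨ cong (λ z → + 2 * z - 1ℤ) (cong +_ (sym r+s≡1+m)) ⟩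
      + 2 * (a + b) - 1ℤ         ∎
      where
      odd : ∀ m → + 2 * m + 1ℤ ≡ + 2 * (1ℤ + m) - 1ℤ
      odd = solve-∀
    pellForm : ∀ a b → (+ 2 * (a + b) - 1ℤ) * (+ 2 * (a + b) - 1ℤ) + 1ℤ
      ≡ + 2 * ((+ 2 * a - 1ℤ) * (+ 2 * a - 1ℤ)) + + 4 * (a * (a - 1ℤ) * ℤ.-1ℤ + b * (b - 1ℤ) * 1ℤ + + 2 * a * b * 1ℤ)
    pellForm = solve-∀

  -- The step (r, b) ↦ (5r + 2b - 2, 2r + b - 1) on red/blue counts corresponds to
  -- (y, v) ↦ (3y + 4v, 2y + 3v) on Pell solutions and preserves the clique weight.
  redsPred blues : ℕ → ℕ
  redsPred zero    = 0
  redsPred (suc i) = 5 ℕ.* redsPred i ℕ.+ 2 ℕ.* blues i ℕ.+ 2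
  blues  zero    = 0
  blues  (suc i) = 2 ℕ.* redsPred i ℕ.+ blues i ℕ.+ 1

  cliqueRule-balanced : ∀ i → twiceCliqueWeight cliqueRule (+ suc (redsPred i)) (+ blues i) ≡ 0ℤ
  cliqueRule-balanced zero    = refl
  cliqueRule-balanced (suc i) = begin
    twiceCliqueWeight cliqueRule (+ suc (redsPred (suc i))) (+ blues (suc i))
      ≡⟨ cong₂ (twiceCliqueWeight cliqueRule) reds′ blues′ ⟩
    twiceCliqueWeight cliqueRule (1ℤ + (+ 5 * s + + 2 * b + + 2)) (+ 2 * s + b + 1ℤ)
      ≡⟨ invariant s b ⟩
    twiceCliqueWeight cliqueRule (1ℤ + s) b
      ≡⟨ cliqueRule-balanced i ⟩
    0ℤ ∎
    where
    open ≡-Reasoning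
    s b : ℤ
    s = + redsPred i
    b = + blues i
    reds′ : + suc (redsPred (suc i)) ≡ 1ℤ + (+ 5 * s + + 2 * b + + 2)
    reds′ = cong₂ (λ x z → 1ℤ + (x + z + + 2)) (ℤP.pos-* 5 (redsPred i)) (ℤP.pos-* 2 (blues i))
    blues′ : + blues (suc i) ≡ + 2 * s + b + 1ℤ
    blues′ = cong (λ x → x + b + 1ℤ) (ℤP.pos-* 2 (redsPred i))
    invariant : ∀ s b →
      let r′ = 1ℤ + (+ 5 * s + + 2 * b + + 2) ; b′ = + 2 * s + b + 1ℤ ; r = 1ℤ + s in
      r′ * (r′ - 1ℤ) * ℤ.-1ℤ + b′ * (b′ - 1ℤ) * 1ℤ + + 2 * r′ * b′ * 1ℤ
        ≡ r * (r - 1ℤ) * ℤ.-1ℤ + b * (b - 1ℤ) * 1ℤ + + 2 * r * b * 1ℤ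
    invariant = solve-∀

  cliqueRule-size : ∀ i → i ≤ suc (redsPred i) ℕ.+ blues i
  cliqueRule-size zero    = z≤n
  cliqueRule-size (suc i) = ℕP.≤-trans (s≤s (cliqueRule-size i)) (grows (redsPred i) (blues i))
    where
    grows : ∀ s b → suc (suc s ℕ.+ b) ≤ suc (5 ℕ.* s ℕ.+ 2 ℕ.* b ℕ.+ 2) ℕ.+ (2 ℕ.* s ℕ.+ b ℕ.+ 1)
    grows s b = subst (suc (suc s ℕ.+ b) ≤_) (expand s b) (ℕP.m≤m+n (suc (suc s ℕ.+ b)) (6 ℕ.* s ℕ.+ 2 ℕ.* b ℕ.+ 2))
      where
      expand : ∀ s b → suc (suc s ℕ.+ b) ℕ.+ (6 ℕ.* s ℕ.+ 2 ℕ.* b ℕ.+ 2) ≡ suc (5 ℕ.* s ℕ.+ 2 ℕ.* b ℕ.+ 2) ℕ.+ (2 ℕ.* s ℕ.+ b ℕ.+ 1)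
      expand = ℕ-Solver.solve-∀

  notS1Case : ∀ m → 1 ≤ m → ¬ InS1 m → ∀ N → GoodWeighting m N
  notS1Case (suc m) _ notS1 N =
    patternGoodWeighting cliqueRule (suc m) N (suc (redsPred N)) (blues N) (cliqueRule-size N) (cliqueRule-balanced N)
      (λ r s r+s≡m weight≡0 → notS1 (cliqueRule-zero⇒S1 r s m r+s≡m weight≡0))

open Constructions using (InS2?; nonSquareCase; notS1Case)

corollary12 : (m : ℕ) → 1 ≤ m → ¬ (InS1 m × InS2 m) →
    (N : ℕ) → ∃ λ n → N ≤ n × ∃ λ (f : Weighting n) → Balanced f ×
    ((H : Subset n) → ∣ H ∣ ≡ m → weightSum f H ≢ 0ℤ)
corollary12 m m≥1 notBoth N with InS2? m
... | yes square    = notS1Case m m≥1 (λ inS1 → notBoth (inS1 , square)) N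
... | no  notSquare = nonSquareCase m notSquare N
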